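{- There exists a quasi-implication algebra that is not a Boolean implication algebra.
   Context: A quasi-implication algebra is a magma $\langle A;\cdot\rangle$ (a set $A$ with a binary operation $\cdot\colon A^2\to A$) satisfying, for all $x,y,z\in A$: (1) $(x\cdot y)\cdot x=x$; (2) $(x\cdot y)\cdot(x\cdot z)=(y\cdot x)\cdot(y\cdot z)$; (3) $((x\cdot y)\cdot(y\cdot x))\cdot x=((y\cdot x)\cdot(x\cdot y))\cdot y$. A Boolean implication algebra is a magma $\langle A;\cdot\rangle$ satisfying, for all $x,y,z\in A$: $(x\cdot y)\cdot x=x$; $(x\cdot y)\cdot y=(y\cdot x)\cdot x$; $x\cdot(y\cdot z)=y\cdot(x\cdot z)$. -}

module Defs where

open import Relation.Binary.PropositionalEquality using (_≡_)
open import Data.Product using (_×_)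

IsQuasiImplicationAlgebra : (A : Set) → (A → A → A) → Set
IsQuasiImplicationAlgebra A _·_ =
  (∀ x y → (x · y) · x ≡ x) ×
  (∀ x y z → (x · y) · (x · z) ≡ (y · x) · (y · z)) ×
  (∀ x y → ((x · y) · (y · x)) · x ≡ ((y · x) · (x · y)) · y)

IsBooleanImplicationAlgebra : (A : Set) → (A → A → A) → Set
IsBooleanImplicationAlgebra A _·_ =
  (∀ x y → (x · y) · x ≡ x) ×
  (∀ x y → (x · y) · y ≡ (y · x) · x) ×
  (∀ x y z → x · (y · z) ≡ y · (x · z))

-- The Sasaki implication x ⇒ y = x⊥ ∨ (x ∧ y) of an orthomodular lattice satisfies the
-- quasi-implication axioms, but not the Boolean implication laws once two elements fail to
-- commute. The smallest witness is MO₂, the horizontal sum of two four-element Boolean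
-- algebras {𝟘, a, a⊥, 𝟙} and {𝟘, b, b⊥, 𝟙}: on this finite lattice the three axioms are
-- checked by evaluation, while for the non-commuting atoms a and b the law
-- (x ⇒ y) ⇒ y = (y ⇒ x) ⇒ x breaks, since (a ⇒ b) ⇒ b = a⊥ ⇒ b = a but (b ⇒ a) ⇒ a = b.
module Submission where

open import Defs
open import Data.Bool using (if_then_else_)
open import Data.Fin using (Fin; zero; suc; _≟_)
open import Data.Fin.Properties using (all?)
open import Data.Product using (Σ; _×_; _,_)
open import Relation.Nullary using (¬_; ⌊_⌋)
open import Relation.Nullary.Decidable using (toWitness)
open import Relation.Binary.PropositionalEquality using (_≡_; _≢_)

infix  8 _⊥
infixr 7 _∧_
infixr 6 _∨_
infixr 5 _⇒_

MO₂ : Set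
MO₂ = Fin 6

pattern 𝟘  = zero
pattern a  = suc zero
pattern a⊥ = suc (suc zero)
pattern b  = suc (suc (suc zero))
pattern b⊥ = suc (suc (suc (suc zero)))
pattern 𝟙  = suc (suc (suc (suc (suc zero))))

_⊥ : MO₂ → MO₂
𝟘 ⊥  = 𝟙
a ⊥  = a⊥
a⊥ ⊥ = a
b ⊥  = b⊥
b⊥ ⊥ = b
𝟙 ⊥  = 𝟘

-- Two distinct elements other than 𝟙 (resp. 𝟘) are either an atom and 𝟘 (resp. 𝟙) or two
-- distinct atoms, whose meet is 𝟘 (resp. join is 𝟙).
_∧_ : MO₂ → MO₂ → MO₂
𝟙 ∧ y = y
x ∧ 𝟙 = x
x ∧ y = if ⌊ x ≟ y ⌋ then x else 𝟘

_∨_ : MO₂ → MO₂ → MO₂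
𝟘 ∨ y = y
x ∨ 𝟘 = x
x ∨ y = if ⌊ x ≟ y ⌋ then x else 𝟙

_⇒_ : MO₂ → MO₂ → MO₂
x ⇒ y = x ⊥ ∨ (x ∧ y)

⇒-contraction : ∀ x y → (x ⇒ y) ⇒ x ≡ x
⇒-contraction = toWitness {a? = all? λ x → all? λ y → ((x ⇒ y) ⇒ x) ≟ x} _

⇒-self-distrib-swap : ∀ x y z → (x ⇒ y) ⇒ (x ⇒ z) ≡ (y ⇒ x) ⇒ (y ⇒ z)
⇒-self-distrib-swap = toWitness {a? = all? λ x → all? λ y → all? λ z →
  ((x ⇒ y) ⇒ (x ⇒ z)) ≟ ((y ⇒ x) ⇒ (y ⇒ z))} _

⇒-quasi-commutative : ∀ x y → ((x ⇒ y) ⇒ (y ⇒ x)) ⇒ x ≡ ((y ⇒ x) ⇒ (x ⇒ y)) ⇒ y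
⇒-quasi-commutative = toWitness {a? = all? λ x → all? λ y →
  (((x ⇒ y) ⇒ (y ⇒ x)) ⇒ x) ≟ (((y ⇒ x) ⇒ (x ⇒ y)) ⇒ y)} _

⇒-not-commutative : (a ⇒ b) ⇒ b ≢ (b ⇒ a) ⇒ a
⇒-not-commutative ()

proposition2p9 : Σ Set (λ A → Σ (A → A → A) (λ _·_ →
                   IsQuasiImplicationAlgebra A _·_ × ¬ IsBooleanImplicationAlgebra A _·_))
proposition2p9 =
  MO₂ , _⇒_ ,
  (⇒-contraction , ⇒-self-distrib-swap , ⇒-quasi-commutative) ,
  λ (_ , ⇒-commutative , _) → ⇒-not-commutative (⇒-commutative a b)
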